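{- For every integer $n\ge 3$, the cycle $C_n$ on $n$ vertices satisfies $\mathcal{G}(C_n)=n \bmod 2$ for \textsc{Closed Geodetic Game}.
   Context: For vertices $x,y$, $\mathcal{I}(x,y)$ is the set of vertices on some shortest $x$–$y$ path ($\mathcal{I}(x,x)=\{x\}$); for a vertex set $S$, the geodetic closure is $(S)=\bigcup_{x,y\in S}\mathcal{I}(x,y)$. \textsc{Closed Geodetic Game} on a graph: starting from $S=\emptyset$, two players alternately add to $S$ a vertex not in the current closure $(S)$; when $(S)$ is the whole vertex set there is no legal move and the game ends; the player making the last move wins. The options of a position are the positions reachable by one legal move; the Sprague–Grundy value is $\mathcal{G}(P)=\operatorname{mex}\{\mathcal{G}(P'):P'\text{ an option of }P\}$, where $\operatorname{mex}(X)$ is the least nonnegative integer not in $X$. $\mathcal{G}(H)$ for a graph $H$ denotes the value of the initial position (nothing selected). -}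

module Defs where

open import Level using (Level; _⊔_) renaming (suc to lsuc)
open import Data.Nat using (ℕ; zero; suc; _≤_; _<_)
open import Data.Fin using (Fin; toℕ)
open import Data.List using (List; []; _∷_)
open import Data.List.Membership.Propositional using (_∈_)
open import Data.Product using (Σ; _×_; _,_)
open import Data.Sum using (_⊎_)
open import Relation.Nullary using (¬_)
open import Relation.Binary.PropositionalEquality using (_≡_; _≢_)

module GraphNotions {a b : Level} (V : Set a) (Adj : V → V → Set b) where

  data Walk : V → V → Set (a ⊔ b) where
    nil  : ∀ {x} → Walk x x
    cons : ∀ {x y z} → Adj x y → Walk y z → Walk x z

  len : ∀ {x y} → Walk x y → ℕ
  len nil        = zero
  len (cons _ w) = suc (len w)

  verts : ∀ {x y} → Walk x y → List V
  verts {x} nil        = x ∷ []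
  verts {x} (cons _ w) = x ∷ verts w

  Shortest : ∀ {x y} → Walk x y → Set (a ⊔ b)
  Shortest {x} {y} w = (w' : Walk x y) → len w ≤ len w'

  InInterval : V → V → V → Set (a ⊔ b)
  InInterval x y z = Σ (Walk x y) λ w → Shortest w × z ∈ verts w

  InClosure : List V → V → Set (a ⊔ b)
  InClosure S z = Σ V λ x → Σ V λ y → x ∈ S × y ∈ S × InInterval x y z

  -- Closed Geodetic Game: a position is the list of selected vertices;
  -- a legal move adds a vertex v not in the current closure.
  data Grundy (S : List V) : ℕ → Set (lsuc (a ⊔ b)) where
    mex : ∀ {g}
        → ((v : V) → ¬ InClosure S v → Σ ℕ λ h → Grundy (v ∷ S) h × h ≢ g)
        → ((k : ℕ) → k < g → Σ V λ v → ¬ InClosure S v × Grundy (v ∷ S) k)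
        → Grundy S g

  GameValue : ℕ → Set (lsuc (a ⊔ b))
  GameValue g = Grundy [] g

CycleStep : (n : ℕ) → Fin n → Fin n → Set
CycleStep n i j = (suc (toℕ i) ≡ toℕ j) ⊎ (suc (toℕ i) ≡ n × toℕ j ≡ 0)

CycleAdj : (n : ℕ) → Fin n → Fin n → Set
CycleAdj n i j = CycleStep n i j ⊎ CycleStep n j i

{-# OPTIONS --safe #-}
-- Identify C_n with ℤ/n. Up to a reflection of the cycle, every position reached after the
-- first move is an arc: the selected vertices lie in {0,…,L}, include 0 and L, and 2L < n, so
-- the geodetic closure is exactly {0,…,L}. A legal move v either extends the arc to {0,…,v},
-- or extends it backwards to an arc of length n − v + L (the reflection z ↦ L − z brings it
-- back to standard form), or closes the whole cycle. With H = ⌈n/2⌉, every length L < L′ < H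
-- is reachable, and a closing move exists unless n is odd and L = 0, so by induction an arc
-- of length L has value H − L, except that a single vertex of an odd cycle has value 0 (it has
-- no antipodal vertex). Hence all options of the empty position have value H ≥ 1 when n is
-- even, and value 0 when n is odd.
module Submission where

open import Defs
open import Level using (Level)
open import Function using (_∘_)
open import Data.Nat
open import Data.Nat.Properties
open import Data.Nat.Tactic.RingSolver using (solve-∀)
open import Data.Nat.Induction using (<-rec)
open import Data.Nat.DivMod using (_/_; _%_; m%n<n; m≡m%n+[m/n]*n; m≥n⇒m/n>0)
open import Data.Fin using (Fin; toℕ; fromℕ<)
open import Data.Fin.Properties using (toℕ-injective; toℕ<n; toℕ-fromℕ<)
open import Data.List using (List; []; _∷_; map)
open import Data.List.Properties using (map-∘; map-cong; map-id)
open import Data.List.Relation.Unary.Any using (here; there)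
open import Data.List.Membership.Propositional using (_∈_)
open import Data.List.Membership.Propositional.Properties using (∈-map⁺; ∈-map⁻)
open import Data.Product using (Σ; _×_; _,_; proj₁; proj₂; swap)
open import Data.Sum using (_⊎_; inj₁; inj₂)
open import Data.Empty using (⊥-elim)
open import Relation.Nullary using (¬_; yes; no; contradiction)
open import Relation.Binary.Definitions using (tri<; tri≈; tri>)
open import Relation.Binary.PropositionalEquality

module GraphProperties {a b : Level} (V : Set a) (Adj : V → V → Set b) where
  open GraphNotions V Adj

  WalkOfLength : ℕ → V → V → Set (a Level.⊔ b)
  WalkOfLength k x y = Σ (Walk x y) λ w → len w ≡ k

  _++ʷ_ : ∀ {x y z} → Walk x y → Walk y z → Walk x z
  nil      ++ʷ w′ = w′
  cons e w ++ʷ w′ = cons e (w ++ʷ w′)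

  len-++ʷ : ∀ {x y z} (w : Walk x y) (w′ : Walk y z) → len (w ++ʷ w′) ≡ len w + len w′
  len-++ʷ nil      w′ = refl
  len-++ʷ (cons e w) w′ = cong suc (len-++ʷ w w′)

  _++ˡ_ : ∀ {j k x y z} → WalkOfLength j x y → WalkOfLength k y z → WalkOfLength (j + k) x z
  (w , p) ++ˡ (w′ , q) = w ++ʷ w′ , trans (len-++ʷ w w′) (cong₂ _+_ p q)

  source∈verts : ∀ {x y} (w : Walk x y) → x ∈ verts w
  source∈verts nil        = here refl
  source∈verts (cons _ _) = here refl

  ∈-verts-++ʷʳ : ∀ {x y z v} (w : Walk x y) {w′ : Walk y z} → v ∈ verts w′ → v ∈ verts (w ++ʷ w′)
  ∈-verts-++ʷʳ nil        v∈ = v∈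
  ∈-verts-++ʷʳ (cons _ w) v∈ = there (∈-verts-++ʷʳ w v∈)

  splitAt : ∀ {x y z} (w : Walk x y) → z ∈ verts w →
            Σ (Walk x z) λ w₁ → Σ (Walk z y) λ w₂ → len w₁ + len w₂ ≡ len w
  splitAt nil        (here refl) = nil , nil , refl
  splitAt (cons e w) (here refl) = nil , cons e w , refl
  splitAt (cons e w) (there z∈) with w₁ , w₂ , eq ← splitAt w z∈ = cons e w₁ , w₂ , cong suc eq

  module Undirected (Adj-sym : ∀ {x y} → Adj x y → Adj y x) where

    reverse : ∀ {x y} → Walk x y → Walk y x
    reverse nil        = nil
    reverse (cons e w) = reverse w ++ʷ cons (Adj-sym e) nil

    len-reverse : ∀ {x y} (w : Walk x y) → len (reverse w) ≡ len w
    len-reverse nil        = refl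
    len-reverse (cons e w) = begin
      len (reverse w ++ʷ cons (Adj-sym e) nil) ≡⟨ len-++ʷ (reverse w) _ ⟩
      len (reverse w) + 1                      ≡⟨ +-comm (len (reverse w)) 1 ⟩
      suc (len (reverse w))                    ≡⟨ cong suc (len-reverse w) ⟩
      suc (len w)                              ∎
      where open ≡-Reasoning

    reverseˡ : ∀ {k x y} → WalkOfLength k x y → WalkOfLength k y x
    reverseˡ (w , p) = reverse w , trans (len-reverse w) p

  module Metric (d : V → V → ℕ) (d-refl : ∀ x → d x x ≡ 0)
                (d-edge : ∀ {x y} z → Adj x y → d x z ≤ suc (d y z))
                (geodesic : ∀ x y → WalkOfLength (d x y) x y) where

    d≤len : ∀ {x y} (w : Walk x y) → d x y ≤ len w
    d≤len {x} nil            = ≤-reflexive (d-refl x)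
    d≤len {y = y} (cons e w) = ≤-trans (d-edge y e) (s≤s (d≤len w))

    interval⇒between : ∀ {x y z} → InInterval x y z → d x z + d z y ≤ d x y
    interval⇒between {x} {y} {z} (w , w-short , z∈w)
      with w₁ , w₂ , split ← splitAt w z∈w | g , len-g ← geodesic x y = begin
      d x z + d z y   ≤⟨ +-mono-≤ (d≤len w₁) (d≤len w₂) ⟩
      len w₁ + len w₂ ≡⟨ split ⟩
      len w           ≤⟨ w-short g ⟩
      len g           ≡⟨ len-g ⟩
      d x y           ∎
      where open ≤-Reasoning

    between⇒interval : ∀ {x y z} → d x z + d z y ≡ d x y → InInterval x y z
    between⇒interval {x} {y} {z} between = w₁ ++ʷ w₂ , shortest , ∈-verts-++ʷʳ w₁ (source∈verts w₂)
      where
      w₁ = proj₁ (geodesic x z)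
      w₂ = proj₁ (geodesic z y)
      shortest : Shortest (w₁ ++ʷ w₂)
      shortest w′ = ≤-trans (≤-reflexive (trans (proj₂ (geodesic x z ++ˡ geodesic z y)) between)) (d≤len w′)

  InClosure-∷ : ∀ {S v z} → InClosure S z → InClosure (v ∷ S) z
  InClosure-∷ (x , y , x∈S , y∈S , z∈I) = x , y , there x∈S , there y∈S , z∈I

  ∉-InClosure-[] : ∀ z → ¬ InClosure [] z
  ∉-InClosure-[] z (x , y , () , _)

  grundy-closed : ∀ {S} → (∀ z → InClosure S z) → Grundy S 0
  grundy-closed closed = mex (λ v v∉ → ⊥-elim (v∉ (closed v))) (λ k ())

  module _ (f : V → V) (f-adj : ∀ {x y} → Adj x y → Adj (f x) (f y)) where

    mapʷ : ∀ {x y} → Walk x y → Walk (f x) (f y)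
    mapʷ nil        = nil
    mapʷ (cons e w) = cons (f-adj e) (mapʷ w)

    len-mapʷ : ∀ {x y} (w : Walk x y) → len (mapʷ w) ≡ len w
    len-mapʷ nil        = refl
    len-mapʷ (cons e w) = cong suc (len-mapʷ w)

    ∈-verts-mapʷ : ∀ {x y z} (w : Walk x y) → z ∈ verts w → f z ∈ verts (mapʷ w)
    ∈-verts-mapʷ nil        (here refl) = here refl
    ∈-verts-mapʷ (cons e w) (here refl) = here refl
    ∈-verts-mapʷ (cons e w) (there z∈)  = there (∈-verts-mapʷ w z∈)

  module Retraction (σ τ : V → V)
                    (σ-adj : ∀ {x y} → Adj x y → Adj (σ x) (σ y))
                    (τ-adj : ∀ {x y} → Adj x y → Adj (τ x) (τ y))
                    (τ∘σ : ∀ x → τ (σ x) ≡ x) where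

    castʷ : ∀ {x x′ y y′} → x ≡ x′ → y ≡ y′ → Walk x y → Walk x′ y′
    castʷ refl refl w = w

    len-castʷ : ∀ {x x′ y y′} (p : x ≡ x′) (q : y ≡ y′) (w : Walk x y) → len (castʷ p q w) ≡ len w
    len-castʷ refl refl w = refl

    shortest-map : ∀ {x y} (w : Walk x y) → Shortest w → Shortest (mapʷ σ σ-adj w)
    shortest-map {x} {y} w w-short w′ = begin
      len (mapʷ σ σ-adj w) ≡⟨ len-mapʷ σ σ-adj w ⟩
      len w                ≤⟨ w-short pulled-back ⟩
      len pulled-back      ≡⟨ len-castʷ (τ∘σ x) (τ∘σ y) _ ⟩
      len (mapʷ τ τ-adj w′) ≡⟨ len-mapʷ τ τ-adj w′ ⟩
      len w′               ∎
      where
      open ≤-Reasoning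
      pulled-back = castʷ (τ∘σ x) (τ∘σ y) (mapʷ τ τ-adj w′)

    closure-map : ∀ {S z} → InClosure S z → InClosure (map σ S) (σ z)
    closure-map (x , y , x∈S , y∈S , w , w-short , z∈w) =
      σ x , σ y , ∈-map⁺ σ x∈S , ∈-map⁺ σ y∈S ,
      mapʷ σ σ-adj w , shortest-map w w-short , ∈-verts-mapʷ σ σ-adj w z∈w

  module Automorphism (σ τ : V → V)
                      (σ-adj : ∀ {x y} → Adj x y → Adj (σ x) (σ y))
                      (τ-adj : ∀ {x y} → Adj x y → Adj (τ x) (τ y))
                      (τ∘σ : ∀ x → τ (σ x) ≡ x) (σ∘τ : ∀ x → σ (τ x) ≡ x) where

    map-τ∘σ : ∀ S → map τ (map σ S) ≡ S
    map-τ∘σ S = trans (sym (map-∘ S)) (trans (map-cong τ∘σ S) (map-id S))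

    ∉-closure-map : ∀ {S v} → ¬ InClosure S v → ¬ InClosure (map σ S) (σ v)
    ∉-closure-map {S} {v} v∉ c =
      v∉ (subst₂ InClosure (map-τ∘σ S) (τ∘σ v) (Retraction.closure-map τ σ τ-adj σ-adj σ∘τ c))

    ∉-closure-unmap : ∀ {S v} → ¬ InClosure (map σ S) v → ¬ InClosure S (τ v)
    ∉-closure-unmap {S} {v} v∉ c =
      v∉ (subst (InClosure (map σ S)) (σ∘τ v) (Retraction.closure-map σ τ σ-adj τ-adj τ∘σ c))

    grundy-map : ∀ {S g} → Grundy S g → Grundy (map σ S) g
    grundy-map {S} {g} (mex no-option-g options-below) = mex no-option-g′ options-below′
      where
      no-option-g′ : (v : V) → ¬ InClosure (map σ S) v → Σ ℕ λ h → Grundy (v ∷ map σ S) h × h ≢ g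
      no-option-g′ v v∉ with h , G , h≢g ← no-option-g (τ v) (∉-closure-unmap v∉) =
        h , subst (λ u → Grundy (u ∷ map σ S) h) (σ∘τ v) (grundy-map G) , h≢g
      options-below′ : (k : ℕ) → k < g → Σ V λ v → ¬ InClosure (map σ S) v × Grundy (v ∷ map σ S) k
      options-below′ k k<g with v , v∉ , G ← options-below k k<g = σ v , ∉-closure-map v∉ , grundy-map G

∣suc-∣ : ∀ i z → ∣ suc i - z ∣ ≡ suc ∣ i - z ∣ ⊎ ∣ i - z ∣ ≡ suc ∣ suc i - z ∣
∣suc-∣ zero    zero    = inj₁ refl
∣suc-∣ (suc i) zero    = inj₁ refl
∣suc-∣ zero    (suc z) = inj₂ refl
∣suc-∣ (suc i) (suc z) = ∣suc-∣ i z

odd≢double : ∀ m n → m + m + 1 ≢ n + n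
odd≢double m n eq = even≢odd n m (begin
  2 * n       ≡⟨ double n ⟨
  n + n       ≡⟨ eq ⟨
  m + m + 1   ≡⟨ +-comm (m + m) 1 ⟩
  suc (m + m) ≡⟨ cong suc (double m) ⟩
  suc (2 * m) ∎)
  where
  open ≡-Reasoning
  double : ∀ k → k + k ≡ 2 * k
  double = solve-∀

<-⊓+⊓ : ∀ {m p q r s} → m < p → m < s → m < q + r → m < p ⊓ q + r ⊓ s
<-⊓+⊓ {m} {p} {q} {r} {s} m<p m<s m<q+r with ⊓-sel p q | ⊓-sel r s
... | inj₁ eq | _       rewrite eq = <-≤-trans m<p (m≤m+n p (r ⊓ s))
... | inj₂ eq | inj₁ eq′ rewrite eq | eq′ = m<q+r
... | inj₂ eq | inj₂ eq′ rewrite eq | eq′ = <-≤-trans m<s (m≤n+m s q)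

m+n≡o⇒o∸m≡n : ∀ {m n o} → m + n ≡ o → o ∸ m ≡ n
m+n≡o⇒o∸m≡n {m} {n} refl = m+n∸m≡n m n

AtMostOneApart : ℕ → ℕ → Set
AtMostOneApart a b = a ≤ suc b × b ≤ suc a

module CyclicDistance (n : ℕ) where

  ∥_∥ : ℕ → ℕ
  ∥ a ∥ = a ⊓ (n ∸ a)

  short-complement : ∀ a b → a + b ≡ n → n ≤ b + b → a + a ≤ n
  short-complement a b a+b≡n n≤b+b = begin
    a + a ≤⟨ +-monoʳ-≤ a (+-cancelʳ-≤ b a b (subst (_≤ b + b) (sym a+b≡n) n≤b+b)) ⟩
    a + b ≡⟨ a+b≡n ⟩
    n     ∎
    where open ≤-Reasoning

  dist : ℕ → ℕ → ℕ
  dist x y = ∥ ∣ x - y ∣ ∥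

  ∥∥-complement : ∀ {a b} → a + b ≡ n → ∥ a ∥ ≡ a ⊓ b
  ∥∥-complement {a} a+b≡n = cong (a ⊓_) (m+n≡o⇒o∸m≡n a+b≡n)

  ∥∥-sym : ∀ {a b} → a + b ≡ n → ∥ a ∥ ≡ ∥ b ∥
  ∥∥-sym {a} {b} a+b≡n = begin
    ∥ a ∥  ≡⟨ ∥∥-complement a+b≡n ⟩
    a ⊓ b  ≡⟨ ⊓-comm a b ⟩
    b ⊓ a  ≡⟨ ∥∥-complement (trans (+-comm b a) a+b≡n) ⟨
    ∥ b ∥  ∎
    where open ≡-Reasoning

  ∥∥-short : ∀ {a} → a + a ≤ n → ∥ a ∥ ≡ a
  ∥∥-short {a} a+a≤n = m≤n⇒m⊓n≡m (m+n≤o⇒m≤o∸n a a+a≤n)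

  ∥∥≤ : ∀ a → ∥ a ∥ ≤ a
  ∥∥≤ a = m⊓n≤m a (n ∸ a)

  ∥∥-suc : ∀ {a} → suc a ≤ n → AtMostOneApart ∥ a ∥ ∥ suc a ∥
  ∥∥-suc {a} sa≤n with b , sa+b≡n ← m≤n⇒∃[o]m+o≡n sa≤n =
    subst₂ AtMostOneApart (sym (∥∥-complement {a} (trans (+-suc a b) sa+b≡n)))
                          (sym (∥∥-complement {suc a} sa+b≡n))
      (⊓-mono-≤ (m≤n⇒m≤1+n (n≤1+n a)) ≤-refl , ⊓-mono-≤ ≤-refl (m≤n⇒m≤1+n (n≤1+n b)))

  dist-self : ∀ x → dist x x ≡ 0
  dist-self x rewrite ∣n-n∣≡0 x = refl

  dist-comm : ∀ x y → dist x y ≡ dist y x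
  dist-comm x y = cong ∥_∥ (∣-∣-comm x y)

  dist-+ʳ : ∀ x a → dist x (x + a) ≡ ∥ a ∥
  dist-+ʳ x a = cong ∥_∥ (∣m-m+n∣≡n x a)

  dist-+ˡ : ∀ x a → dist (x + a) x ≡ ∥ a ∥
  dist-+ˡ x a = trans (dist-comm (x + a) x) (dist-+ʳ x a)

  dist-n : ∀ {z} → z ≤ n → dist n z ≡ dist 0 z
  dist-n {z} z≤n′ = begin
    ∥ ∣ n - z ∣ ∥ ≡⟨ cong ∥_∥ (trans (∣-∣-comm n z) (m≤n⇒∣m-n∣≡n∸m z≤n′)) ⟩
    ∥ n ∸ z ∥     ≡⟨ ∥∥-sym (m+[n∸m]≡n z≤n′) ⟨
    ∥ z ∥         ∎
    where open ≡-Reasoning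

  ∣-∣≤n : ∀ {x y} → x ≤ n → y ≤ n → ∣ x - y ∣ ≤ n
  ∣-∣≤n {x} {y} x≤n y≤n = ≤-trans (∣m-n∣≤m⊔n x y) (⊔-lub x≤n y≤n)

  dist-suc : ∀ {i z} → suc i ≤ n → z ≤ n → AtMostOneApart (dist i z) (dist (suc i) z)
  dist-suc {i} {z} si≤n z≤n′ with ∣suc-∣ i z
  ... | inj₁ eq = subst (λ w → AtMostOneApart (dist i z) ∥ w ∥) (sym eq)
                    (∥∥-suc (subst (_≤ n) eq (∣-∣≤n si≤n z≤n′)))
  ... | inj₂ eq = subst (λ w → AtMostOneApart ∥ w ∥ (dist (suc i) z)) (sym eq)
                    (swap (∥∥-suc (subst (_≤ n) eq (∣-∣≤n (<⇒≤ si≤n) z≤n′))))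

  dist-between : ∀ {x z y k} → x ≤ z → z ≤ y → x + k ≡ y → k + k ≤ n →
                 dist x z + dist z y ≡ dist x y
  dist-between {x} {k = k} x≤z z≤y x+k≡y short
    with p , refl ← m≤n⇒∃[o]m+o≡n x≤z | q , refl ← m≤n⇒∃[o]m+o≡n z≤y = begin
    dist x (x + p) + dist (x + p) (x + p + q) ≡⟨ cong₂ _+_ (dist-+ʳ x p) (dist-+ʳ (x + p) q) ⟩
    ∥ p ∥ + ∥ q ∥                              ≡⟨ cong₂ _+_ (∥∥-short {p} p-short) (∥∥-short {q} q-short) ⟩
    p + q                                      ≡⟨ ∥∥-short {p + q} pq-short ⟨
    ∥ p + q ∥                                  ≡⟨ dist-+ʳ x (p + q) ⟨
    dist x (x + (p + q))                       ≡⟨ cong (dist x) (+-assoc x p q) ⟨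
    dist x (x + p + q)                         ∎
    where
    open ≡-Reasoning
    pq-short : (p + q) + (p + q) ≤ n
    pq-short = subst (λ l → l + l ≤ n) (+-cancelˡ-≡ x k (p + q) (trans x+k≡y (+-assoc x p q))) short
    p-short = ≤-trans (+-mono-≤ (m≤m+n p q) (m≤m+n p q)) pq-short
    q-short = ≤-trans (+-mono-≤ (m≤n+m q p) (m≤n+m q p)) pq-short

  dist-between-0 : ∀ {x z k} → x ≤ z → z ≤ n → x + k ≡ n → k + k ≤ n →
                   dist x z + dist z 0 ≡ dist x 0
  dist-between-0 {x} {z} x≤z z≤n′ x+k≡n short =
    subst₂ (λ d d′ → dist x z + d ≡ d′) (n≈0 z≤n′) (n≈0 (≤-trans x≤z z≤n′))
           (dist-between x≤z z≤n′ x+k≡n short)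
    where
    n≈0 : ∀ {y} → y ≤ n → dist y n ≡ dist y 0
    n≈0 {y} y≤n = trans (dist-comm y n) (trans (dist-n y≤n) (dist-comm 0 y))

  -- For z = x + t + u = n − c the two summands are dist x z and dist z (x + t): each leg may go
  -- either way around the cycle.
  exterior-bound : ∀ {x t u c} → 0 < u → 0 < c → (t + u) + (x + c) ≡ n → t + t < n →
                   t < (t + u) ⊓ (x + c) + u ⊓ (x + t + c)
  exterior-bound {x} {t} {u} {c} 0<u 0<c t+u+x+c≡n short =
    <-⊓+⊓ (m<m+n t 0<u) (≤-<-trans (m≤n+m t x) (m<m+n (x + t) 0<c))
          (+-cancelˡ-< t t (x + c + u) (begin-strict
            t + t               <⟨ short ⟩
            n                   ≡⟨ t+u+x+c≡n ⟨
            (t + u) + (x + c)   ≡⟨ rearrange t u x c ⟩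
            t + (x + c + u)     ∎))
    where
    open ≤-Reasoning
    rearrange : ∀ t u x c → (t + u) + (x + c) ≡ t + (x + c + u)
    rearrange = solve-∀

  dist-exterior-≤ : ∀ {L x y z} → x ≤ y → y ≤ L → L < z → z < n → L + L < n →
                    dist x y < dist x z + dist z y
  dist-exterior-≤ {L} {x} x≤y y≤L L<z z<n short
    with t , refl ← m≤n⇒∃[o]m+o≡n x≤y
       | a , refl ← m≤n⇒∃[o]m+o≡n (≤-<-trans y≤L L<z)
       | c , sz+c≡n ← m≤n⇒∃[o]m+o≡n z<n = begin-strict
    dist x (x + t)                                      ≡⟨ dist-+ʳ x t ⟩
    ∥ t ∥                                               ≤⟨ ∥∥≤ t ⟩
    t                                                   <⟨ exterior-bound z<s z<s eq₁ t-short ⟩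
    (t + suc a) ⊓ (x + suc c) + suc a ⊓ (x + t + suc c) ≡⟨ cong₂ _+_ (∥∥-complement {t + suc a} eq₁)
                                                                       (∥∥-complement {suc a} eq₂) ⟨
    ∥ t + suc a ∥ + ∥ suc a ∥                           ≡⟨ cong₂ _+_ dist-xz dist-zy ⟨
    dist x z + dist z (x + t)                           ∎
    where
    open ≤-Reasoning
    z = suc (x + t + a)
    z≡y+sa : z ≡ x + t + suc a
    z≡y+sa = sym (+-suc (x + t) a)
    dist-xz : dist x z ≡ ∥ t + suc a ∥
    dist-xz = trans (cong (dist x) (trans z≡y+sa (+-assoc x t (suc a)))) (dist-+ʳ x (t + suc a))
    dist-zy : dist z (x + t) ≡ ∥ suc a ∥
    dist-zy = trans (cong (λ w → dist w (x + t)) z≡y+sa) (dist-+ˡ (x + t) (suc a))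
    eq₁ : (t + suc a) + (x + suc c) ≡ n
    eq₁ = trans (rearrange x t a c) sz+c≡n
      where
      rearrange : ∀ x t a c → (t + suc a) + (x + suc c) ≡ suc (suc (x + t + a)) + c
      rearrange = solve-∀
    eq₂ : suc a + (x + t + suc c) ≡ n
    eq₂ = trans (rearrange x t a c) sz+c≡n
      where
      rearrange : ∀ x t a c → suc a + (x + t + suc c) ≡ suc (suc (x + t + a)) + c
      rearrange = solve-∀
    t-short : t + t < n
    t-short = ≤-<-trans (+-mono-≤ t≤L t≤L) short
      where t≤L = ≤-trans (m≤n+m t x) y≤L

  dist-exterior : ∀ {L x y z} → x ≤ L → y ≤ L → L < z → z < n → L + L < n →
                  dist x y < dist x z + dist z y
  dist-exterior {L} {x} {y} {z} x≤L y≤L L<z z<n short with ≤-total x y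
  ... | inj₁ x≤y = dist-exterior-≤ x≤y y≤L L<z z<n short
  ... | inj₂ y≤x = subst₂ _<_ (dist-comm y x)
                           (trans (+-comm (dist y z) (dist z x)) (cong₂ _+_ (dist-comm z x) (dist-comm y z)))
                     (dist-exterior-≤ y≤x x≤L L<z z<n short)

  Stepℕ : ℕ → ℕ → Set
  Stepℕ i j = suc i ≡ j ⊎ (suc i ≡ n × j ≡ 0)

  mirror : ℕ → ℕ → ℕ
  mirror L z with z ≤? L
  ... | yes _ = L ∸ z
  ... | no  _ = n + L ∸ z

  mirror-≤ : ∀ {L z t} → z + t ≡ L → mirror L z ≡ t
  mirror-≤ {L} {z} {t} z+t≡L with z ≤? L
  ... | yes _   = m+n≡o⇒o∸m≡n z+t≡L
  ... | no  z≰L = contradiction (subst (z ≤_) z+t≡L (m≤m+n z t)) z≰L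

  mirror-> : ∀ {L z t} → L < z → z + t ≡ n + L → mirror L z ≡ t
  mirror-> {L} {z} L<z z+t≡n+L with z ≤? L
  ... | yes z≤L = contradiction z≤L (<⇒≱ L<z)
  ... | no  _   = m+n≡o⇒o∸m≡n z+t≡n+L

  mirror<n : ∀ {L z} → L < n → z < n → mirror L z < n
  mirror<n {L} {z} L<n z<n with z ≤? L
  ... | yes z≤L = ≤-<-trans (m∸n≤m L z) L<n
  ... | no  z≰L = +-cancelʳ-< z (n + L ∸ z) n (begin-strict
    n + L ∸ z + z ≡⟨ m∸n+n≡m (≤-trans (<⇒≤ z<n) (m≤m+n n L)) ⟩
    n + L         <⟨ +-monoʳ-< n (≰⇒> z≰L) ⟩
    n + z         ∎)
    where open ≤-Reasoning

  mirror-involutive : ∀ {L z} → z < n → mirror L (mirror L z) ≡ z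
  mirror-involutive {L} {z} z<n with z ≤? L
  ... | yes z≤L = mirror-≤ (m∸n+n≡m z≤L)
  ... | no  z≰L = mirror-> L<n+L∸z (m∸n+n≡m (≤-trans (<⇒≤ z<n) (m≤m+n n L)))
    where
    L<n+L∸z : L < n + L ∸ z
    L<n+L∸z = subst (L <_) (sym (+-∸-comm L (<⇒≤ z<n))) (m<n+m L (m<n⇒0<n∸m z<n))

  mirror-above : ∀ {L z s} → L < z → z + s ≡ n → mirror L z ≡ s + L
  mirror-above {L} {z} {s} L<z z+s≡n = mirror-> L<z (trans (sym (+-assoc z s L)) (cong (_+ L) z+s≡n))

  mirror-step : ∀ {L i j} → L < n → j < n → Stepℕ i j → Stepℕ (mirror L j) (mirror L i)
  mirror-step {L} {i} L<n j<n (inj₁ refl) with <-cmp i L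
  ... | tri< i<L _ _ with t , si+t≡L ← m≤n⇒∃[o]m+o≡n i<L =
    inj₁ (trans (cong suc (mirror-≤ si+t≡L)) (sym (mirror-≤ (trans (+-suc i t) si+t≡L))))
  ... | tri≈ _ refl _ with r , ssi+r≡n ← m≤n⇒∃[o]m+o≡n j<n =
    inj₂ (trans (cong suc (mirror-above {s = suc r} ≤-refl (trans (+-suc (suc i) r) ssi+r≡n)))
                (trans (cong (suc ∘ suc) (+-comm r i)) ssi+r≡n) ,
          mirror-≤ (+-identityʳ i))
  ... | tri> _ _ L<i with r , ssi+r≡n ← m≤n⇒∃[o]m+o≡n j<n =
    inj₁ (trans (cong suc (mirror-above (m<n⇒m<1+n L<i) (trans (+-suc (suc i) r) ssi+r≡n)))
                (sym (mirror-above L<i (trans (+-suc i (suc r)) (trans (+-suc (suc i) r) ssi+r≡n)))))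
  mirror-step {L} {i} L<n j<n (inj₂ (si≡n , refl)) with <-cmp i L
  ... | tri< i<L _ _ = contradiction (subst (_≤ L) si≡n i<L) (<⇒≱ L<n)
  ... | tri≈ _ refl _ = inj₂ (si≡n , mirror-≤ (+-identityʳ i))
  ... | tri> _ _ L<i = inj₁ (sym (mirror-> L<i (trans (+-suc i L) (cong (_+ L) si≡n))))

module CycleGraph (n : ℕ) where
  open CyclicDistance n
  open GraphNotions (Fin n) (CycleAdj n)
  open GraphProperties (Fin n) (CycleAdj n)

  CycleAdj-sym : ∀ {x y} → CycleAdj n x y → CycleAdj n y x
  CycleAdj-sym = Data.Sum.swap

  open Undirected CycleAdj-sym

  distance : Fin n → Fin n → ℕ
  distance x y = dist (toℕ x) (toℕ y)

  distance-step : ∀ {x y} → CycleStep n x y → ∀ z → AtMostOneApart (distance x z) (distance y z)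
  distance-step {x} {y} (inj₁ sx≡y) z =
    subst (λ j → AtMostOneApart (distance x z) (dist j (toℕ z))) sx≡y
          (dist-suc (subst (_≤ n) (sym sx≡y) (<⇒≤ (toℕ<n y))) (<⇒≤ (toℕ<n z)))
  distance-step {x} {y} (inj₂ (sx≡n , y≡0)) z =
    subst (λ j → AtMostOneApart (distance x z) j) (trans dist-sx≡dist-0 (cong (λ j → dist j (toℕ z)) (sym y≡0)))
          (dist-suc (≤-reflexive sx≡n) (<⇒≤ (toℕ<n z)))
    where
    dist-sx≡dist-0 : dist (suc (toℕ x)) (toℕ z) ≡ dist 0 (toℕ z)
    dist-sx≡dist-0 = trans (cong (λ j → dist j (toℕ z)) sx≡n) (dist-n (<⇒≤ (toℕ<n z)))

  distance-edge : ∀ {x y} z → CycleAdj n x y → distance x z ≤ suc (distance y z)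
  distance-edge z (inj₁ step) = proj₁ (distance-step step z)
  distance-edge z (inj₂ step) = proj₂ (distance-step step z)

  ascend : ∀ k {x y : Fin n} → toℕ x + k ≡ toℕ y → WalkOfLength k x y
  ascend zero {x} {y} x+0≡y with refl ← toℕ-injective (trans (sym (+-identityʳ (toℕ x))) x+0≡y) = nil , refl
  ascend (suc k) {x} {y} x+sk≡y = (cons edge nil , refl) ++ˡ ascend k x′+k≡y
    where
    sx<n : suc (toℕ x) < n
    sx<n = ≤-<-trans (subst (toℕ x <_) x+sk≡y (m<m+n (toℕ x) z<s)) (toℕ<n y)
    edge : CycleAdj n x (fromℕ< sx<n)
    edge = inj₁ (inj₁ (sym (toℕ-fromℕ< sx<n)))
    x′+k≡y : toℕ (fromℕ< sx<n) + k ≡ toℕ y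
    x′+k≡y = trans (cong (_+ k) (toℕ-fromℕ< sx<n)) (trans (sym (+-suc (toℕ x) k)) x+sk≡y)

  geodesic-≤ : ∀ x y → toℕ x ≤ toℕ y → WalkOfLength (distance x y) x y
  geodesic-≤ x y x≤y with a , x+a≡y ← m≤n⇒∃[o]m+o≡n x≤y | a + a ≤? n
  ... | yes short = subst (λ k → WalkOfLength k x y) (sym distance≡a) (ascend a x+a≡y)
    where
    distance≡a : distance x y ≡ a
    distance≡a = trans (cong (dist (toℕ x)) (sym x+a≡y)) (trans (dist-+ʳ (toℕ x) a) (∥∥-short short))
  ... | no long with c , sy+c≡n ← m≤n⇒∃[o]m+o≡n (toℕ<n y) =
    subst (λ k → WalkOfLength k x y) (sym distance≡)
          (down-to-origin ++ˡ ((cons wrap nil , refl) ++ˡ down-to-y))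
    where
    0<n : 0 < n
    0<n = ≤-<-trans z≤n (toℕ<n y)
    y+c<n : toℕ y + c < n
    y+c<n = ≤-reflexive sy+c≡n
    origin last : Fin n
    origin = fromℕ< 0<n
    last = fromℕ< y+c<n
    wrap : CycleAdj n origin last
    wrap = inj₂ (inj₂ (trans (cong suc (toℕ-fromℕ< y+c<n)) sy+c≡n , toℕ-fromℕ< 0<n))
    down-to-origin : WalkOfLength (toℕ x) x origin
    down-to-origin = reverseˡ (ascend (toℕ x) (cong (_+ toℕ x) (toℕ-fromℕ< 0<n)))
    down-to-y : WalkOfLength c last y
    down-to-y = reverseˡ (ascend c (sym (toℕ-fromℕ< y+c<n)))
    complement : a + (toℕ x + suc c) ≡ n
    complement = trans (rearrange a (toℕ x) c) (trans (cong (λ t → suc t + c) x+a≡y) sy+c≡n)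
      where
      rearrange : ∀ a x c → a + (x + suc c) ≡ suc (x + a) + c
      rearrange = solve-∀
    wrap-shorter : toℕ x + suc c ≤ a
    wrap-shorter = <⇒≤ (+-cancelˡ-< a _ _ (subst (_< a + a) (sym complement) (≰⇒> long)))
    distance≡ : distance x y ≡ toℕ x + suc c
    distance≡ = begin
      distance x y             ≡⟨ cong (dist (toℕ x)) (sym x+a≡y) ⟩
      dist (toℕ x) (toℕ x + a) ≡⟨ dist-+ʳ (toℕ x) a ⟩
      ∥ a ∥                    ≡⟨ ∥∥-complement complement ⟩
      a ⊓ (toℕ x + suc c)      ≡⟨ m≥n⇒m⊓n≡n wrap-shorter ⟩
      toℕ x + suc c            ∎
      where open ≡-Reasoning

  geodesic : ∀ x y → WalkOfLength (distance x y) x y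
  geodesic x y with ≤-total (toℕ x) (toℕ y)
  ... | inj₁ x≤y = geodesic-≤ x y x≤y
  ... | inj₂ y≤x = subst (λ k → WalkOfLength k x y) (dist-comm (toℕ y) (toℕ x))
                        (reverseˡ (geodesic-≤ y x y≤x))

  open Metric distance (dist-self ∘ toℕ) distance-edge geodesic public

  module Reflection (L : ℕ) (L<n : L < n) where

    reflect : Fin n → Fin n
    reflect z = fromℕ< (mirror<n L<n (toℕ<n z))

    toℕ-reflect : ∀ z → toℕ (reflect z) ≡ mirror L (toℕ z)
    toℕ-reflect z = toℕ-fromℕ< _

    reflect-involutive : ∀ z → reflect (reflect z) ≡ z
    reflect-involutive z = toℕ-injective (begin
      toℕ (reflect (reflect z))  ≡⟨ toℕ-reflect (reflect z) ⟩
      mirror L (toℕ (reflect z)) ≡⟨ cong (mirror L) (toℕ-reflect z) ⟩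
      mirror L (mirror L (toℕ z)) ≡⟨ mirror-involutive (toℕ<n z) ⟩
      toℕ z                      ∎)
      where open ≡-Reasoning

    reflect-step : ∀ {x y} → CycleStep n x y → CycleStep n (reflect y) (reflect x)
    reflect-step {x} {y} step = subst₂ Stepℕ (sym (toℕ-reflect y)) (sym (toℕ-reflect x))
                                       (mirror-step L<n (toℕ<n y) step)

    reflect-adj : ∀ {x y} → CycleAdj n x y → CycleAdj n (reflect x) (reflect y)
    reflect-adj (inj₁ step) = inj₂ (reflect-step step)
    reflect-adj (inj₂ step) = inj₁ (reflect-step step)

    open Automorphism reflect reflect reflect-adj reflect-adj reflect-involutive reflect-involutive public

    grundy-unreflect : ∀ {S g} → Grundy (map reflect S) g → Grundy S g
    grundy-unreflect {S} {g} G = subst (λ T → Grundy T g) (map-τ∘σ S) (grundy-map G)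

  record Arc (L : ℕ) (S : List (Fin n)) : Set where
    field
      short      : L + L < n
      origin     : Fin n
      origin∈S   : origin ∈ S
      toℕ-origin : toℕ origin ≡ 0
      end        : Fin n
      end∈S      : end ∈ S
      toℕ-end    : toℕ end ≡ L
      within     : ∀ {s} → s ∈ S → toℕ s ≤ L

    L<n : L < n
    L<n = ≤-<-trans (m≤m+n L L) short

  module _ {L S} (arc : Arc L S) where
    open Arc arc

    arc-closure⁺ : ∀ {z} → toℕ z ≤ L → InClosure S z
    arc-closure⁺ {z} z≤L =
      origin , end , origin∈S , end∈S ,
      between⇒interval (dist-between (subst (_≤ toℕ z) (sym toℕ-origin) z≤n)
                                     (subst (toℕ z ≤_) (sym toℕ-end) z≤L)
                                     (trans (cong (_+ L) toℕ-origin) (sym toℕ-end))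
                                     (<⇒≤ short))

    arc-closure⁻ : ∀ {z} → InClosure S z → toℕ z ≤ L
    arc-closure⁻ {z} (x , y , x∈S , y∈S , z∈I) with toℕ z ≤? L
    ... | yes z≤L = z≤L
    ... | no  z≰L = contradiction (interval⇒between z∈I)
                      (<⇒≱ (dist-exterior (within x∈S) (within y∈S) (≰⇒> z≰L) (toℕ<n z) short))

    arc-extend : ∀ {v} → L < toℕ v → toℕ v + toℕ v < n → Arc (toℕ v) (v ∷ S)
    arc-extend {v} L<v v-short = record
      { short = v-short ; origin = origin ; origin∈S = there origin∈S ; toℕ-origin = toℕ-origin
      ; end = v ; end∈S = here refl ; toℕ-end = refl
      ; within = λ { (here refl) → ≤-refl ; (there s∈S) → ≤-trans (within s∈S) (<⇒≤ L<v) } }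

    arc-cover : ∀ {v p q} → L + p ≡ toℕ v → p + p ≤ n → toℕ v + q ≡ n → q + q ≤ n →
                ∀ z → InClosure (v ∷ S) z
    arc-cover {v} L+p≡v p-short v+q≡n q-short z with toℕ z ≤? L | toℕ z ≤? toℕ v
    ... | yes z≤L | _       = InClosure-∷ (arc-closure⁺ z≤L)
    ... | no z≰L  | yes z≤v =
      end , v , there end∈S , here refl ,
      between⇒interval (dist-between (subst (_≤ toℕ z) (sym toℕ-end) (<⇒≤ (≰⇒> z≰L))) z≤v
                                     (trans (cong (_+ _) toℕ-end) L+p≡v) p-short)
    ... | no _    | no z≰v  =
      v , origin , here refl , there origin∈S ,
      between⇒interval (subst (λ o → dist (toℕ v) (toℕ z) + dist (toℕ z) o ≡ dist (toℕ v) o) (sym toℕ-origin)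
                                (dist-between-0 (<⇒≤ (≰⇒> z≰v)) (<⇒≤ (toℕ<n z)) v+q≡n q-short))

    arc-reflect : ∀ {v q} → L < toℕ v → toℕ v + q ≡ n → (q + L) + (q + L) < n →
                  Arc (q + L) (map (Reflection.reflect L L<n) (v ∷ S))
    arc-reflect {v} {q} L<v v+q≡n short′ = record
      { short = short′
      ; origin = reflect end ; origin∈S = there (∈-map⁺ reflect end∈S)
      ; toℕ-origin = trans (toℕ-reflect end) (trans (cong (mirror L) toℕ-end) (mirror-≤ (+-identityʳ L)))
      ; end = reflect v ; end∈S = here refl ; toℕ-end = toℕ-reflect-v
      ; within = within′ }
      where
      open Reflection L L<n
      toℕ-reflect-v : toℕ (reflect v) ≡ q + L
      toℕ-reflect-v = trans (toℕ-reflect v) (mirror-above L<v v+q≡n)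
      within′ : ∀ {s} → s ∈ map reflect (v ∷ S) → toℕ s ≤ q + L
      within′ (here refl) = ≤-reflexive toℕ-reflect-v
      within′ (there s∈) with s₀ , s₀∈S , refl ← ∈-map⁻ reflect s∈
                          with t , s₀+t≡L ← m≤n⇒∃[o]m+o≡n (within s₀∈S) = begin
        toℕ (reflect s₀) ≡⟨ trans (toℕ-reflect s₀) (mirror-≤ s₀+t≡L) ⟩
        t                ≤⟨ subst (t ≤_) s₀+t≡L (m≤n+m t (toℕ s₀)) ⟩
        L                ≤⟨ m≤n+m L q ⟩
        q + L            ∎
        where open ≤-Reasoning

    data Extension (v : Fin n) : Set where
      forward  : L < toℕ v → Arc (toℕ v) (v ∷ S) → Extension v
      backward : ∀ {L′} → L < L′ → Arc L′ (map (Reflection.reflect L L<n) (v ∷ S)) → Extension v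
      covering : ∀ {q} → toℕ v + q ≡ n → n ≤ toℕ v + toℕ v → n ≤ (q + L) + (q + L) →
                 (∀ z → InClosure (v ∷ S) z) → Extension v

    extension-beyond : ∀ {v q} → L < toℕ v → toℕ v + suc q ≡ n → Extension v
    extension-beyond {v} {q} L<v v+q≡n with toℕ v + toℕ v <? n | (suc q + L) + (suc q + L) <? n
    ... | yes v-short | _          = forward L<v (arc-extend L<v v-short)
    ... | no _        | yes short′ = backward (m<n+m L z<s) (arc-reflect L<v v+q≡n short′)
    ... | no v-long   | no long′ with p , L+p≡v ← m≤n⇒∃[o]m+o≡n (<⇒≤ L<v) =
      covering v+q≡n (≮⇒≥ v-long) (≮⇒≥ long′) (arc-cover L+p≡v p-short v+q≡n q-short)
      where
      rearrange : ∀ p q L → p + (q + L) ≡ L + p + q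
      rearrange = solve-∀
      p-short : p + p ≤ n
      p-short = short-complement p (suc q + L)
                  (trans (rearrange p (suc q) L) (trans (cong (_+ suc q) L+p≡v) v+q≡n)) (≮⇒≥ long′)
      q-short : suc q + suc q ≤ n
      q-short = short-complement (suc q) (toℕ v) (trans (+-comm (suc q) (toℕ v)) v+q≡n) (≮⇒≥ v-long)

    extension : ∀ {v} → ¬ InClosure S v → Extension v
    extension {v} v∉ with q , sv+q≡n ← m≤n⇒∃[o]m+o≡n (toℕ<n v) =
      extension-beyond (≰⇒> (v∉ ∘ arc-closure⁺)) (trans (+-suc (toℕ v) q) sv+q≡n)

  singleton-arc : ∀ {w} → toℕ w ≡ 0 → Arc 0 (w ∷ [])
  singleton-arc {w} w≡0 = record
    { short = ≤-<-trans z≤n (toℕ<n w)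
    ; origin = w ; origin∈S = here refl ; toℕ-origin = w≡0
    ; end = w ; end∈S = here refl ; toℕ-end = w≡0
    ; within = λ { (here refl) → ≤-reflexive w≡0 } }

  singleton-value : ∀ {g} → (∀ {w} → Arc 0 (w ∷ []) → Grundy (w ∷ []) g) → ∀ v → Grundy (v ∷ []) g
  singleton-value value v =
    grundy-unreflect (value (singleton-arc (trans (toℕ-reflect v) (mirror-≤ (+-identityʳ (toℕ v))))))
    where open Reflection (toℕ v) (toℕ<n v)

  module Game (h e : ℕ) (h+h+e≡n : h + h + e ≡ n) (e≤1 : e ≤ 1) (1≤h : 1 ≤ h) where

    H : ℕ
    H = h + e

    h+H≡n : h + H ≡ n
    h+H≡n = trans (sym (+-assoc h h e)) h+h+e≡n

    short⇒<H : ∀ {L} → L + L < n → L < H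
    short⇒<H {L} short = ≰⇒> λ H≤L → <⇒≱ short (begin
      n     ≡⟨ h+H≡n ⟨
      h + H ≤⟨ +-mono-≤ (≤-trans (m≤m+n h e) H≤L) H≤L ⟩
      L + L ∎)
      where open ≤-Reasoning

    <H⇒short : ∀ {L} → L < H → L + L < n
    <H⇒short {L} L<H = ≤-pred (begin
      suc (suc (L + L)) ≡⟨ cong suc (+-suc L L) ⟨
      suc L + suc L ≤⟨ +-mono-≤ L<H L<H ⟩
      H + H         ≡⟨ rearrange h e ⟩
      h + h + e + e ≡⟨ cong (_+ e) h+h+e≡n ⟩
      n + e         ≤⟨ +-monoʳ-≤ n e≤1 ⟩
      n + 1         ≡⟨ +-comm n 1 ⟩
      suc n         ∎)
      where
      open ≤-Reasoning
      rearrange : ∀ h e → (h + e) + (h + e) ≡ h + h + e + e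
      rearrange = solve-∀

    -- L > 0 or n even
    Closable : ℕ → Set
    Closable L = e ≤ L + L

    closable-above : ∀ {L L′} → L < L′ → Closable L′
    closable-above {L′ = L′} L<L′ = ≤-trans e≤1 (≤-trans (≤-trans (s≤s z≤n) L<L′) (m≤m+n L′ L′))

    closing-move : ∀ {L S} → Arc L S → Closable L →
                   Σ (Fin n) λ v → ¬ InClosure S v × (∀ z → InClosure (v ∷ S) z)
    closing-move {L} {S} arc closable = v , v∉ , arc-cover arc (sym toℕ-v) h-short v+q≡n q-short
      where
      L<H = short⇒<H (Arc.short arc)
      L+h<n : L + h < n
      L+h<n = subst (L + h <_) (trans (+-comm H h) h+H≡n) (+-monoˡ-< h L<H)
      v = fromℕ< L+h<n
      toℕ-v : toℕ v ≡ L + h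
      toℕ-v = toℕ-fromℕ< L+h<n
      v∉ : ¬ InClosure S v
      v∉ v∈ = <⇒≱ (subst (L <_) (sym toℕ-v) (m<m+n L 1≤h)) (arc-closure⁻ arc v∈)
      h-short : h + h ≤ n
      h-short = subst (h + h ≤_) h+h+e≡n (m≤m+n (h + h) e)
      v+q≡n : toℕ v + (H ∸ L) ≡ n
      v+q≡n = begin
        toℕ v + (H ∸ L)   ≡⟨ cong (_+ (H ∸ L)) toℕ-v ⟩
        L + h + (H ∸ L)   ≡⟨ rearrange L h (H ∸ L) ⟩
        h + (L + (H ∸ L)) ≡⟨ cong (h +_) (m+[n∸m]≡n (<⇒≤ L<H)) ⟩
        h + H             ≡⟨ h+H≡n ⟩
        n                 ∎
        where
        open ≡-Reasoning
        rearrange : ∀ L h q → L + h + q ≡ h + (L + q)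
        rearrange = solve-∀
      q-short : (H ∸ L) + (H ∸ L) ≤ n
      q-short = short-complement (H ∸ L) (toℕ v) (trans (+-comm (H ∸ L) (toℕ v)) v+q≡n) (begin
        n                     ≡⟨ h+h+e≡n ⟨
        h + h + e             ≤⟨ +-monoʳ-≤ (h + h) closable ⟩
        h + h + (L + L)       ≡⟨ rearrange h L ⟩
        (L + h) + (L + h)     ≡⟨ cong₂ _+_ toℕ-v toℕ-v ⟨
        toℕ v + toℕ v         ∎)
        where
        open ≤-Reasoning
        rearrange : ∀ h L → h + h + (L + L) ≡ (L + h) + (L + h)
        rearrange = solve-∀

    growing-move : ∀ {L S L′} → Arc L S → L < L′ → L′ < H →
                   Σ (Fin n) λ v → ¬ InClosure S v × Arc L′ (v ∷ S)
    growing-move {L} {S} {L′} arc L<L′ L′<H = v , v∉ , subst (λ l → Arc l (v ∷ S)) toℕ-v arc′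
      where
      L′<n : L′ < n
      L′<n = ≤-<-trans (m≤m+n L′ L′) (<H⇒short L′<H)
      v = fromℕ< L′<n
      toℕ-v : toℕ v ≡ L′
      toℕ-v = toℕ-fromℕ< L′<n
      L<v : L < toℕ v
      L<v = subst (L <_) (sym toℕ-v) L<L′
      arc′ : Arc (toℕ v) (v ∷ S)
      arc′ = arc-extend arc L<v (subst (λ l → l + l < n) (sym toℕ-v) (<H⇒short L′<H))
      v∉ : ¬ InClosure S v
      v∉ v∈ = <⇒≱ L<v (arc-closure⁻ arc v∈)

    -- Well-founded induction on the value H ∸ L, which drops along every move that does not
    -- close the cycle.
    ArcValue : ℕ → Set₁
    ArcValue m = ∀ {L S} → H ∸ L ≡ m → Closable L → Arc L S → Grundy S m

    arc-value : ∀ {L S} → Closable L → Arc L S → Grundy S (H ∸ L)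
    arc-value = <-rec ArcValue value _ refl
      where
      value : ∀ m → (∀ {m′} → m′ < m → ArcValue m′) → ArcValue m
      value _ rec {L} {S} refl closable arc = mex no-option options-below
        where
        L<H : L < H
        L<H = short⇒<H (Arc.short arc)
        smaller : ∀ {L′ S′} → L < L′ → Arc L′ S′ → H ∸ L′ < H ∸ L
        smaller L<L′ arc′ = ∸-monoʳ-< L<L′ (<⇒≤ (short⇒<H (Arc.short arc′)))
        larger : ∀ {L′ S′} → L < L′ → Arc L′ S′ → Grundy S′ (H ∸ L′)
        larger L<L′ arc′ = rec (smaller L<L′ arc′) refl (closable-above L<L′) arc′
        no-option : (v : Fin n) → ¬ InClosure S v → Σ ℕ λ g → Grundy (v ∷ S) g × g ≢ H ∸ L
        no-option v v∉ with extension arc v∉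
        ... | forward L<v arc′ = H ∸ toℕ v , larger L<v arc′ , <⇒≢ (smaller L<v arc′)
        ... | backward L<L′ arc′ = _ , Reflection.grundy-unreflect L (Arc.L<n arc) (larger L<L′ arc′) ,
                                   <⇒≢ (smaller L<L′ arc′)
        ... | covering _ _ _ closed = 0 , grundy-closed closed , <⇒≢ (m<n⇒0<n∸m L<H)
        options-below : (k : ℕ) → k < H ∸ L → Σ (Fin n) λ v → ¬ InClosure S v × Grundy (v ∷ S) k
        options-below zero _ with v , v∉ , closed ← closing-move arc closable = v , v∉ , grundy-closed closed
        options-below (suc k) k<m =
          let v , v∉ , arc′ = growing-move arc L<L′ L′<H
          in  v , v∉ , subst (Grundy (v ∷ S)) H∸L′≡k (larger L<L′ arc′)
          where
          sk≤H : suc k ≤ H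
          sk≤H = ≤-trans (<⇒≤ k<m) (m∸n≤m H L)
          H∸L′≡k : H ∸ (H ∸ suc k) ≡ suc k
          H∸L′≡k = m∸[m∸n]≡n sk≤H
          L<L′ : L < H ∸ suc k
          L<L′ = ≰⇒> λ L′≤L → <⇒≱ k<m (≤-trans (∸-monoʳ-≤ H L′≤L) (≤-reflexive H∸L′≡k))
          L′<H : H ∸ suc k < H
          L′<H = ∸-monoʳ-< z<s sk≤H

    odd-origin-value : e ≡ 1 → ∀ {S} → Arc 0 S → Grundy S 0
    odd-origin-value e≡1 {S} arc = mex no-option (λ _ ())
      where
      larger : ∀ {L′ S′} → 0 < L′ → Arc L′ S′ → Σ ℕ λ g → Grundy S′ g × g ≢ 0
      larger {L′} 0<L′ arc′ = H ∸ L′ , arc-value (closable-above 0<L′) arc′ ,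
                              n>0⇒n≢0 (m<n⇒0<n∸m (short⇒<H {L′} (Arc.short arc′)))
      no-option : (v : Fin n) → ¬ InClosure S v → Σ ℕ λ g → Grundy (v ∷ S) g × g ≢ 0
      no-option v v∉ with extension arc v∉
      ... | forward 0<v arc′ = larger 0<v arc′
      ... | backward 0<L′ arc′ with g , G , g≢0 ← larger 0<L′ arc′ =
        g , Reflection.grundy-unreflect 0 (Arc.L<n arc) G , g≢0
      ... | covering {q} v+q≡n n≤v+v n≤q+q _ = contradiction (trans h+h+1≡n n≡v+v) (odd≢double h (toℕ v))
        where
        h+h+1≡n : h + h + 1 ≡ n
        h+h+1≡n = subst (λ e → h + h + e ≡ n) e≡1 h+h+e≡n
        n≡v+v : n ≡ toℕ v + toℕ v
        n≡v+v = ≤-antisym n≤v+v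
                  (short-complement (toℕ v) q v+q≡n (subst (λ l → n ≤ l + l) (+-identityʳ q) n≤q+q))

    empty-value-even : e ≡ 0 → Grundy [] 0
    empty-value-even e≡0 =
      mex (λ v _ → H , singleton-value (arc-value (≤-reflexive e≡0)) v , n>0⇒n≢0 0<H) (λ _ ())
      where
      0<H : 0 < H
      0<H = ≤-trans 1≤h (m≤m+n h e)

    empty-value-odd : e ≡ 1 → Grundy [] 1
    empty-value-odd e≡1 = mex (λ v _ → 0 , origin-value v , λ ())
                              (λ { zero _ → v₀ , ∉-InClosure-[] v₀ , origin-value v₀ ; (suc _) (s≤s ()) })
      where
      origin-value : ∀ v → Grundy (v ∷ []) 0
      origin-value = singleton-value (odd-origin-value e≡1)
      0<n : 0 < n
      0<n = subst (0 <_) h+h+e≡n (≤-trans 1≤h (≤-trans (m≤m+n h h) (m≤m+n (h + h) e)))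
      v₀ : Fin n
      v₀ = fromℕ< 0<n

    empty-value : Grundy [] e
    empty-value with m≤n⇒m<n∨m≡n e≤1
    ... | inj₁ e<1 = subst (Grundy []) (sym (n<1⇒n≡0 e<1)) (empty-value-even (n<1⇒n≡0 e<1))
    ... | inj₂ e≡1 = subst (Grundy []) (sym e≡1) (empty-value-odd e≡1)

theorem2 : (n : ℕ) → 3 ≤ n → GraphNotions.GameValue (Fin n) (CycleAdj n) (n % 2)
theorem2 n 3≤n = CycleGraph.Game.empty-value n (n / 2) (n % 2) h+h+e≡n (≤-pred (m%n<n n 2)) 1≤h
  where
  h+h+e≡n : n / 2 + n / 2 + n % 2 ≡ n
  h+h+e≡n = trans (rearrange (n / 2) (n % 2)) (sym (m≡m%n+[m/n]*n n 2))
    where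
    rearrange : ∀ h e → h + h + e ≡ e + h * 2
    rearrange = solve-∀
  1≤h : 1 ≤ n / 2
  1≤h = m≥n⇒m/n>0 (≤-trans (s≤s (s≤s z≤n)) 3≤n)
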